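{- Let $G$ be a monograph on $n$ vertices with signature $S=\{s_1<\dots<s_n\}$, and let $m$ be the number of negative elements of $S$ (so $s_1,\dots,s_m<0\le s_{m+1}$). Suppose $0\notin S$ and the vertex $\pi(s_n)$ is adjacent to every vertex $\pi(s_i)$ with $s_i>0$, $i\ne n$. Then $s_{m+j}+s_{n-j}=s_n$ for every $j$ with $1\le j\le n-m-1$; that is, $s_n=s_{m+1}+s_{n-1}=s_{m+2}+s_{n-2}=\dots=s_{\lfloor (m+n)/2\rfloor}+s_{\lceil (m+n)/2\rceil}$.
   Context: A finite simple graph $G=(V,E)$ is an autograph with signature $S$ (a finite multiset of integers) if there is a bijection $\pi$ from the elements of $S$ to $V$ such that for any two distinct elements $s,t$ of $S$, $\pi(s)$ and $\pi(t)$ are adjacent iff $|s-t|\in S$. $G$ is a monograph if it has a signature $S$ that is a set. -}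

module Defs where

open import Data.Nat using (ℕ; suc; _<_)
open import Data.Fin using (Fin; toℕ)
open import Data.Integer using (ℤ; _-_; ∣_∣; +_)
import Data.Integer as ℤ
open import Data.Product using (∃; _×_)
open import Relation.Binary.PropositionalEquality using (_≡_)
open import Relation.Nullary using (¬_)
open import Function.Bundles using (_⤖_; _⇔_; Bijection)

record SimpleGraph (n : ℕ) : Set₁ where
  field
    Adj      : Fin n → Fin n → Set
    symmetric  : ∀ {u v} → Adj u v → Adj v u
    irreflexive : ∀ {v} → ¬ Adj v v

-- G is an autograph with signature {s i} via bijection π from signature
-- positions to vertices: for distinct positions i ≠ j,
-- π i ~ π j  iff  |s i - s j| ∈ S.
-- (|x| is the natural-number absolute value, cast back to ℤ.)
InSig : ∀ {n} → (Fin n → ℤ) → ℤ → Set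
InSig s x = ∃ λ k → s k ≡ x

IsAutographVia : ∀ {n} → SimpleGraph n → (Fin n → ℤ) → (Fin n ⤖ Fin n) → Set
IsAutographVia {n} G s π =
  ∀ (i j : Fin n) → ¬ i ≡ j →
    (SimpleGraph.Adj G (Bijection.to π i) (Bijection.to π j) ⇔ InSig s (+ ∣ s i - s j ∣))

-- s is strictly increasing: S = {s_1 < ... < s_n} is a set, listed in order.
StrictlyIncreasing : ∀ {n} → (Fin n → ℤ) → Set
StrictlyIncreasing {n} s = ∀ (i j : Fin n) → toℕ i < toℕ j → s i ℤ.< s j

module Submission where

-- Put N = n - 1, the position of the largest element
-- T = s_N.  Since 0 ∉ S, the positions m, …, N - 1 carry exactly the positive
-- elements below T.  For each of them the vertex π(s_N) is adjacent to
-- π(s_i), so T - s_i ∈ S; being positive and below T it again sits in the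
-- window [m, N).  Thus every position of the window has a complementary
-- position (s_i + s_k = T), and complementation reverses the order.

open import Defs
open import Data.Nat using (ℕ; _+_; _∸_; _≤_; _<_; suc; zero; z≤n; s≤s; s≤s⁻¹)
import Data.Nat.Properties as ℕ
open import Data.Fin using (Fin; toℕ; fromℕ<)
open import Data.Fin.Properties using (toℕ<n; toℕ-fromℕ<; toℕ-injective)
open import Data.Integer using (ℤ; +_; ∣_∣)
import Data.Integer as ℤ
import Data.Integer.Properties as ℤ
open import Data.Product using (_×_; ∃; _,_)
open import Data.Sum using (inj₁; inj₂)
open import Relation.Binary.PropositionalEquality
  using (_≡_; refl; sym; trans; cong; subst; module ≡-Reasoning)
open import Relation.Nullary using (¬_)
open import Function.Bundles using (_⤖_; _⇔_; Bijection; Equivalence)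

<∸⇒≤∸suc : ∀ {x} b t → x < b ∸ t → x ≤ b ∸ suc t
<∸⇒≤∸suc {x} b t x<b∸t =
  subst (x ≤_) (ℕ.pred[m∸n]≡m∸[1+n] b t) (ℕ.pred-mono-≤ x<b∸t)

-- Order-reversing pairings of a window [a, b) of ℕ: R is total on the window
-- (every x has a partner y in it) and reverses the order.  Such a relation is
-- dominated by the reflection x ↦ a + b - 1 - x from both sides.
module WindowPairing (R : ℕ → ℕ → Set) (a b : ℕ)
  (complement : ∀ x → a ≤ x → x < b → ∃ λ y → a ≤ y × y < b × R x y)
  (antitone : ∀ {x x′ y y′} → R x y → R x′ y′ → x < x′ → y′ < y)
  where

  mirror-in-window : ∀ t → a + t < b → a ≤ b ∸ suc t × b ∸ suc t < b
  mirror-in-window t a+t<b =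
      ℕ.m+n≤o⇒m≤o∸n a (subst (_≤ b) (sym (ℕ.+-suc a t)) a+t<b)
    , ℕ.∸-monoʳ-< (s≤s z≤n) (ℕ.≤-<-trans (ℕ.m≤n+m t a) a+t<b)

  shrink : ∀ t → a + suc t < b → a + t < b
  shrink t = ℕ.<-trans (ℕ.+-monoʳ-< a (ℕ.n<1+n t))

  upper : ∀ t → a + t < b → ∃ λ y → y ≤ b ∸ suc t × R (a + t) y
  upper zero a<b with complement (a + 0) (ℕ.m≤m+n a 0) a<b
  ... | y , _ , y<b , r = y , <∸⇒≤∸suc b 0 y<b , r
  upper (suc t) a+t+1<b with upper t (shrink t a+t+1<b)
                            | complement (a + suc t) (ℕ.m≤m+n a (suc t)) a+t+1<b
  ... | y , y≤ , r | y′ , _ , _ , r′ = y′ , <∸⇒≤∸suc b (suc t) y′<b∸t+1 , r′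
    where
    y′<b∸t+1 : y′ < b ∸ suc t
    y′<b∸t+1 = ℕ.<-≤-trans (antitone r r′ (ℕ.+-monoʳ-< a (ℕ.n<1+n t))) y≤

  lower : ∀ t → a + t < b → ∃ λ y → a + t ≤ y × R (b ∸ suc t) y
  lower zero a<b with mirror-in-window zero a<b
  ... | a≤ , <b with complement (b ∸ 1) a≤ <b
  ... | y , a≤y , _ , r = y , subst (_≤ y) (sym (ℕ.+-identityʳ a)) a≤y , r
  lower (suc t) a+t+1<b with lower t (shrink t a+t+1<b) | mirror-in-window (suc t) a+t+1<b
  ... | y , a+t≤y , r | a≤ , <b with complement (b ∸ suc (suc t)) a≤ <b
  ... | y′ , _ , _ , r′ =
    y′ , subst (_≤ y′) (sym (ℕ.+-suc a t)) (ℕ.≤-<-trans a+t≤y (antitone r′ r step)) , r′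
    where
    step : b ∸ suc (suc t) < b ∸ suc t
    step = ℕ.∸-monoʳ-< (ℕ.n<1+n (suc t))
             (ℕ.≤-trans (ℕ.m≤n+m (suc (suc t)) a)
                        (subst (_≤ b) (sym (ℕ.+-suc a (suc t))) a+t+1<b))

module Increasing {n : ℕ} (s : Fin n → ℤ) (inc : StrictlyIncreasing s) where

  monotone : ∀ i j → toℕ i ≤ toℕ j → s i ℤ.≤ s j
  monotone i j i≤j with ℕ.m≤n⇒m<n∨m≡n i≤j
  ... | inj₁ i<j = ℤ.<⇒≤ (inc i j i<j)
  ... | inj₂ i≡j rewrite toℕ-injective {i = i} {j = j} i≡j = ℤ.≤-refl

  reflect< : ∀ i j → s i ℤ.< s j → toℕ i < toℕ j
  reflect< i j si<sj = ℕ.≰⇒> λ j≤i → ℤ.<⇒≱ si<sj (monotone j i j≤i)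

complement-antitone : ∀ {a c a′ c′ T : ℤ} →
  a ℤ.+ c ≡ T → a′ ℤ.+ c′ ≡ T → a ℤ.< a′ → c′ ℤ.< c
complement-antitone a+c≡T a′+c′≡T a<a′ = ℤ.≰⇒> λ c≤c′ →
  ℤ.<-irrefl (trans a+c≡T (sym a′+c′≡T)) (ℤ.+-mono-<-≤ a<a′ c≤c′)

squeeze : ∀ {a b c d T : ℤ} →
  a ℤ.+ c ≡ T → b ℤ.+ d ≡ T → c ℤ.≤ b → a ℤ.≤ d → a ℤ.+ b ≡ T
squeeze {a} {b} {c} {d} a+c≡T b+d≡T c≤b a≤d = ℤ.≤-antisym a+b≤T T≤a+b
  where
  a+b≤T : a ℤ.+ b ℤ.≤ _
  a+b≤T = subst (a ℤ.+ b ℤ.≤_) (trans (ℤ.+-comm d b) b+d≡T) (ℤ.+-monoˡ-≤ b a≤d)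
  T≤a+b : _ ℤ.≤ a ℤ.+ b
  T≤a+b = subst (ℤ._≤ a ℤ.+ b) a+c≡T (ℤ.+-monoʳ-≤ a c≤b)

complement-sum : ∀ (T x : ℤ) → x ℤ.≤ T → x ℤ.+ (+ ∣ T ℤ.- x ∣) ≡ T
complement-sum T x x≤T = begin
  x ℤ.+ (+ ∣ T ℤ.- x ∣)  ≡⟨ cong (λ y → x ℤ.+ y) (ℤ.0≤i⇒+∣i∣≡i (ℤ.i≤j⇒0≤j-i x≤T)) ⟩
  x ℤ.+ (T ℤ.- x)        ≡⟨ ℤ.+-comm x (T ℤ.- x) ⟩
  (T ℤ.- x) ℤ.+ x        ≡⟨ ℤ.+-assoc T (ℤ.- x) x ⟩
  T ℤ.+ (ℤ.- x ℤ.+ x)    ≡⟨ cong (λ y → T ℤ.+ y) (ℤ.+-inverseˡ x) ⟩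
  T ℤ.+ + 0              ≡⟨ ℤ.+-identityʳ T ⟩
  T                      ∎
  where open ≡-Reasoning

module Complements {n : ℕ} (G : SimpleGraph n) (s : Fin n → ℤ) (π : Fin n ⤖ Fin n)
    (inc : StrictlyIncreasing s)
    (aut : IsAutographVia G s π)
    (m : ℕ)
    (neg : ∀ (i : Fin n) → (s i ℤ.< + 0) ⇔ (toℕ i < m))
    (nz : ∀ (i : Fin n) → ¬ s i ≡ + 0)
    (top : Fin n)
    (adj : ∀ (i : Fin n) → + 0 ℤ.< s i → ¬ i ≡ top
         → SimpleGraph.Adj G (Bijection.to π top) (Bijection.to π i))
  where

  open Increasing s inc

  T : ℤ
  T = s top

  N : ℕ
  N = toℕ top

  positive : ∀ i → m ≤ toℕ i → + 0 ℤ.< s i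
  positive i m≤i =
    ℤ.≤∧≢⇒< (ℤ.≮⇒≥ λ si<0 → ℕ.<⇒≱ (Equivalence.to (neg i) si<0) m≤i)
            (λ 0≡si → nz i (sym 0≡si))

  positive-position : ∀ i → + 0 ℤ.< s i → m ≤ toℕ i
  positive-position i 0<si =
    ℕ.≮⇒≥ λ i<m → ℤ.<-asym (Equivalence.from (neg i) i<m) 0<si

  -- Adjacency of π(T) with π(s_i) puts T - s_i into S, at a position of the
  -- window [m, N) again.
  complement : ∀ i → m ≤ toℕ i → toℕ i < N →
               ∃ λ k → m ≤ toℕ k × toℕ k < N × s i ℤ.+ s k ≡ T
  complement i m≤i i<N
    with Equivalence.to (aut top i (λ top≡i → i≢top (sym top≡i))) (adj i 0<si i≢top)
    where
    0<si : + 0 ℤ.< s i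
    0<si = positive i m≤i
    i≢top : ¬ i ≡ top
    i≢top i≡top = ℕ.<-irrefl (cong toℕ i≡top) i<N
  ... | k , sk≡ = k , positive-position k 0<sk , reflect< k top sk<T , sum
    where
    si<T : s i ℤ.< T
    si<T = inc i top i<N
    sum : s i ℤ.+ s k ≡ T
    sum = trans (cong (λ y → s i ℤ.+ y) sk≡) (complement-sum T (s i) (ℤ.<⇒≤ si<T))
    0<sk : + 0 ℤ.< s k
    0<sk = complement-antitone sum (ℤ.+-identityʳ T) si<T
    sk<T : s k ℤ.< T
    sk<T = complement-antitone (ℤ.+-identityˡ T) sum (positive i m≤i)

  record Complementary (x y : ℕ) : Set where
    constructor complementary
    field
      left right : Fin n
      left-at    : toℕ left ≡ x
      right-at   : toℕ right ≡ y
      sums       : s left ℤ.+ s right ≡ T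

  window-complement : ∀ x → m ≤ x → x < N → ∃ λ y → m ≤ y × y < N × Complementary x y
  window-complement x m≤x x<N
    with complement i (subst (m ≤_) (sym i-at) m≤x) (subst (_< N) (sym i-at) x<N)
    where
    x<n : x < n
    x<n = ℕ.<-trans x<N (toℕ<n top)
    i : Fin n
    i = fromℕ< x<n
    i-at : toℕ i ≡ x
    i-at = toℕ-fromℕ< x<n
  ... | k , m≤k , k<N , sum = toℕ k , m≤k , k<N , complementary _ k (toℕ-fromℕ< _) refl sum

  window-antitone : ∀ {x x′ y y′} →
    Complementary x y → Complementary x′ y′ → x < x′ → y′ < y
  window-antitone (complementary u v refl refl sum) (complementary u′ v′ refl refl sum′) x<x′ =
    reflect< v′ v (complement-antitone sum sum′ (inc u u′ x<x′))

  partner : ∀ {x y} → Complementary x y → ∀ i → toℕ i ≡ x →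
            ∃ λ k → toℕ k ≡ y × s i ℤ.+ s k ≡ T
  partner (complementary u v u-at v-at sum) i i-at
    rewrite toℕ-injective {i = i} {j = u} (trans i-at (sym u-at)) = v , v-at , sum

  open WindowPairing Complementary m N window-complement window-antitone

  mirror-sum : ∀ t → m + t < N → ∀ i i′ → toℕ i ≡ m + t → toℕ i′ ≡ N ∸ suc t →
               s i ℤ.+ s i′ ≡ T
  mirror-sum t m+t<N i i′ i-at i′-at with upper t m+t<N | lower t m+t<N
  ... | y , y≤ , c | y′ , ≤y′ , c′ with partner c i i-at | partner c′ i′ i′-at
  ... | k , refl , sum | k′ , refl , sum′ =
    squeeze sum sum′ (monotone k i′ (subst (toℕ k ≤_) (sym i′-at) y≤))
                     (monotone i k′ (subst (_≤ toℕ k′) (sym i-at) ≤y′))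

-- Position arithmetic for the index j = t + 1 of the theorem (N = n - 1):
-- the hypothesis j + m + 1 ≤ n puts m + t in the window [m, N), ...
window-bound : ∀ t m N → suc t + m + 1 ≤ suc N → m + t < N
window-bound t m N le = subst (_≤ N) t+m+1≡ (s≤s⁻¹ le)
  where
  t+m+1≡ : t + m + 1 ≡ suc (m + t)
  t+m+1≡ = trans (ℕ.+-comm (t + m) 1) (cong suc (ℕ.+-comm t m))

-- ... and the index n - j - 1 is the mirror position N - 1 - t.
mirror-position : ∀ N t → N ∸ t ∸ 1 ≡ N ∸ suc t
mirror-position N t = trans (ℕ.∸-+-assoc N t 1) (cong (N ∸_) (ℕ.+-comm t 1))

lemma2 : (n : ℕ) (G : SimpleGraph n) (s : Fin n → ℤ) (π : Fin n ⤖ Fin n)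
    → StrictlyIncreasing s
    → IsAutographVia G s π
    → (m : ℕ) → m ≤ n
    → (∀ (i : Fin n) → (s i ℤ.< + 0) ⇔ (toℕ i < m))
    → (∀ (i : Fin n) → ¬ s i ≡ + 0)
    → (top : Fin n) → suc (toℕ top) ≡ n
    → (∀ (i : Fin n) → + 0 ℤ.< s i → ¬ i ≡ top
         → SimpleGraph.Adj G (Bijection.to π top) (Bijection.to π i))
    → (j : ℕ) (j≥1 : 1 ≤ j) (j≤ : j + m + 1 ≤ n)
    → (p : m + j ∸ 1 < n) (q : n ∸ j ∸ 1 < n)
    → s (fromℕ< p) ℤ.+ s (fromℕ< q) ≡ s top
lemma2 n G s π inc aut m _ neg nz top n≡N+1 adj (suc t) _ j≤ p q =
  mirror-sum t (window-bound t m N (subst (suc t + m + 1 ≤_) (sym n≡N+1) j≤))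
    (fromℕ< p) (fromℕ< q)
    (trans (toℕ-fromℕ< p) (cong (_∸ 1) (ℕ.+-suc m t)))
    (trans (toℕ-fromℕ< q)
           (trans (cong (λ x → x ∸ suc t ∸ 1) (sym n≡N+1)) (mirror-position N t)))
  where open Complements G s π inc aut m neg nz top adj
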